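{- Let $n\ge1$ and let $\lambda\in P(n)$ be a partition at which $N(0,3;\lambda)$ attains its maximum over $P(n)$. For $i\ge1$ let $m_i$ be the number of parts of $\lambda$ equal to $i$. If $a>b$ are integers with $a,b\ne7$ and $m_a=m_b=1$, then $(a,b)\in\{(4,1),(13,10)\}$.
   Context: $P(n)$ is the set of partitions of $n$. $N(0,3;m)$ is the number of partitions of $m$ whose rank (largest part minus number of parts) is divisible by $3$, and for $\lambda=(\lambda_1,\dots,\lambda_k)$, $N(0,3;\lambda):=\prod_{j=1}^kN(0,3;\lambda_j)$. -}

module Defs where

open import Data.Nat using (ℕ; zero; suc; _+_; _≤_; _≥_; _<_; _≤?_; _∸_; _≟_)
open import Data.Nat.Divisibility using (_∣?_)
open import Data.Integer using (ℤ; +_; _-_; ∣_∣)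
open import Data.Integer.Divisibility using (_∣_)
open import Data.List using (List; []; _∷_; map; concatMap; filter; upTo; length)
open import Data.Nat.ListAction using (sum; product)
open import Relation.Nullary.Decidable using (does)
open import Data.Bool using (true; false)
open import Relation.Unary using (Pred; Decidable)
open import Data.List.Relation.Unary.All using (All)
open import Data.List.Relation.Binary.Pointwise using ()
open import Data.List.Relation.Unary.Linked using (Linked)
open import Relation.Binary.PropositionalEquality using (_≡_)
open import Relation.Nullary.Decidable using (Dec; _×-dec_)
open import Data.Product using (_×_)
import Data.Nat.Properties as ℕP

count : {P : ℕ → Set} → ((x : ℕ) → Dec (P x)) → List ℕ → ℕ
count p []       = 0
count p (x ∷ xs) with does (p x)
... | true  = suc (count p xs)
... | false = count p xs

IsPartition : ℕ → List ℕ → Set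
IsPartition n λs = Linked _≥_ λs × All (λ x → 1 ≤ x) λs × sum λs ≡ n

-- Explicit enumeration: partsBounded m k = all partitions of m with parts ≤ k
-- (listed as weakly decreasing lists).  Fuel f ≥ m ensures termination.
partsFuel : ℕ → ℕ → ℕ → List (List ℕ)
partsFuel _       zero    _ = [] ∷ []
partsFuel zero    (suc m) _ = []
partsFuel (suc f) (suc m) k =
  concatMap (λ j → map (λ rest → suc j ∷ rest) (partsFuel f (suc m ∸ suc j) (suc j)))
            (filter (λ j → suc j ≤? k) (filter (λ j → suc j ≤? suc m) (upTo (suc m))))

partitions : ℕ → List (List ℕ)
partitions m = partsFuel m m m

largest : List ℕ → ℕ
largest []      = 0
largest (x ∷ _) = x

-- rank = largest part minus number of parts (an integer); for the empty
-- partition this is 0.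
rank : List ℕ → ℤ
rank λs = + largest λs - + length λs

count' : {P : List ℕ → Set} → ((x : List ℕ) → Dec (P x)) → List (List ℕ) → ℕ
count' p []       = 0
count' p (x ∷ xs) with does (p x)
... | true  = suc (count' p xs)
... | false = count' p xs

rank3? : (λs : List ℕ) → Dec ((+ 3) ∣ rank λs)
rank3? λs = 3 ∣? ∣ rank λs ∣

N03 : ℕ → ℕ
N03 m = count' rank3? (partitions m)

N03P : List ℕ → ℕ
N03P λs = product (map N03 λs)

mult : ℕ → List ℕ → ℕ
mult i λs = count (_≟_ i) λs

-- Replacing a part x of a partition by parts with the same sum multiplies N(0,3;·) by
-- the ratio of their weights, so in a maximising partition no part, and no pair of
-- distinct parts, can be replaced profitably.  Every x outside {1,3,4,6,7,9,10,13,16}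
-- has a profitable replacement, essentially x = 7 + 7 + ⋯: for x ≤ 33 this is checked
-- by computing N(0,3;x), for 34 ≤ x ≤ 55 by computing the partition number
-- p(x) ≥ N(0,3;x), and for x ≥ 56 it follows from p(x) ≤ C (6/5)^x, because
-- 6^7 < 7 · 5^7 = N(0,3;7) · 5^7.  The exponential bound comes from dominating the
-- recurrence for partitions into parts ≤ k by G(k) 6^m, where G(k) grows like
-- ∏_{j ≤ k} (1 - (5/6)^j)⁻¹.  Among pairs of distinct admissible parts other than 7,
-- only (4,1) and (13,10) cannot be merged profitably.
module Submission where

open import Defs
open import Data.Nat
open import Data.Nat.Properties
open import Data.Nat.DivMod using (_/_; _%_; m≡m%n+[m/n]*n; m%n<n)
open import Data.Nat.ListAction using (sum; product)
open import Data.Nat.ListAction.Properties using (sum-++; product-++; sum-↭; product-↭)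
open import Data.Nat.Solver using (module +-*-Solver)
open +-*-Solver using (solve; _:*_; _:+_; _:=_; con)
open import Algebra.Properties.CommutativeSemigroup *-commutativeSemigroup using (x∙yz≈y∙xz)
open import Data.Bool using (true; false)
open import Data.List
  using (List; []; _∷_; _++_; [_]; map; filter; upTo; applyUpTo; length; concatMap; replicate)
open import Data.List.Properties
  using ( length-++; length-map; map-++; filter-++; filter-accept; filter-reject
        ; upTo-∷ʳ; ++-identityʳ)
open import Data.List.Membership.Propositional using (_∈_)
open import Data.List.Membership.DecPropositional _≟_ using (_∈?_)
open import Data.List.Relation.Unary.All as All using (All; []; _∷_; all?)
open import Data.List.Relation.Unary.All.Properties using (++⁺; ++⁻ʳ)
open import Data.List.Relation.Unary.Any using (Any; here; there)
open import Data.List.Relation.Binary.Permutation.Propositional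
  using (_↭_; ↭-refl; ↭-sym; ↭-trans; ↭-prep; ↭-swap)
open import Data.List.Relation.Binary.Permutation.Propositional.Properties
  using (All-resp-↭; ∈-resp-↭; map⁺)
open import Relation.Binary.Properties.DecTotalOrder ≤-decTotalOrder using (≥-decTotalOrder)
open import Data.List.Sort ≥-decTotalOrder using (sort; sort-↭; sort-↗)
open import Data.Product using (∃; _×_; _,_)
open import Data.Sum using (_⊎_; inj₁; inj₂)
open import Function using (_∘_)
open import Relation.Binary.PropositionalEquality hiding ([_])
open import Relation.Nullary using (Dec; yes; no; does; contradiction)
open import Relation.Nullary.Decidable
  using (True; toWitness; map′; ¬?; _×-dec_; _⊎-dec_; _→-dec_)

byDecision : ∀ {A : Set} (a? : Dec A) → does a? ≡ true → A
byDecision (yes a) _  = a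
byDecision (no _)  ()

-- Exchanging parts of a maximal partition

Positive : List ℕ → Set
Positive = All (1 ≤_)

Decomposes : ℕ → List ℕ → Set
Decomposes n xs = Positive xs × sum xs ≡ n

weight : (ℕ → ℕ) → List ℕ → ℕ
weight f xs = product (map f xs)

IsMaximal : (ℕ → ℕ) → ℕ → List ℕ → Set
IsMaximal f n λs = ∀ μ → IsPartition n μ → weight f μ ≤ weight f λs

weight-++ : ∀ f xs ys → weight f (xs ++ ys) ≡ weight f xs * weight f ys
weight-++ f xs ys = trans (cong product (map-++ f xs ys)) (product-++ (map f xs) (map f ys))

weight-↭ : ∀ f {xs ys} → xs ↭ ys → weight f xs ≡ weight f ys
weight-↭ f σ = product-↭ (map⁺ f σ)

sort-isPartition : ∀ {n} xs → Decomposes n xs → IsPartition n (sort xs)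
sort-isPartition xs (pos , total) =
  sort-↗ xs , All-resp-↭ (↭-sym (sort-↭ xs)) pos , trans (sum-↭ (sort-↭ xs)) total

replicate-1-decomposes : ∀ n → Decomposes n (replicate n 1)
replicate-1-decomposes zero    = [] , refl
replicate-1-decomposes (suc n) with pos , total ← replicate-1-decomposes n =
  ≤-refl ∷ pos , cong suc total

1≤weight-replicate-1 : ∀ {f} → 1 ≤ f 1 → ∀ n → 1 ≤ weight f (replicate n 1)
1≤weight-replicate-1 f1 zero    = ≤-refl
1≤weight-replicate-1 f1 (suc n) = *-mono-≤ f1 (1≤weight-replicate-1 f1 n)

1≤weight-maximal : ∀ {f n λs} → 1 ≤ f 1 → IsMaximal f n λs → 1 ≤ weight f λs
1≤weight-maximal {f} {n} {λs} f1 maximal = begin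
  1                               ≤⟨ 1≤weight-replicate-1 f1 n ⟩
  weight f (replicate n 1)        ≡⟨ weight-↭ f (sort-↭ (replicate n 1)) ⟨
  weight f (sort (replicate n 1)) ≤⟨ maximal _ (sort-isPartition _ (replicate-1-decomposes n)) ⟩
  weight f λs                     ∎
  where open ≤-Reasoning

exchange : ∀ {f n λs} → 1 ≤ f 1 → IsPartition n λs → IsMaximal f n λs →
           ∀ {old rest new} → λs ↭ old ++ rest → Decomposes (sum old) new →
           weight f new ≤ weight f old
exchange {f} {n} {λs} f1 (_ , pos , total) maximal {old} {rest} {new} σ (posNew , sumNew) =
  *-cancelʳ-≤ (weight f new) (weight f old) (weight f rest) ⦃ restNonZero ⦄ (begin
    weight f new * weight f rest   ≡⟨ weight-++ f new rest ⟨
    weight f (new ++ rest)         ≡⟨ weight-↭ f (sort-↭ (new ++ rest)) ⟨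
    weight f (sort (new ++ rest))
      ≤⟨ maximal _ (sort-isPartition _ (++⁺ posNew posRest , newTotal)) ⟩
    weight f λs                    ≡⟨ oldWeight ⟩
    weight f old * weight f rest   ∎)
  where
  open ≤-Reasoning
  oldWeight : weight f λs ≡ weight f old * weight f rest
  oldWeight = trans (weight-↭ f σ) (weight-++ f old rest)
  posRest : Positive rest
  posRest = ++⁻ʳ old (All-resp-↭ σ pos)
  newTotal : sum (new ++ rest) ≡ n
  newTotal = begin-equality
    sum (new ++ rest)    ≡⟨ sum-++ new rest ⟩
    sum new + sum rest   ≡⟨ cong (_+ sum rest) sumNew ⟩
    sum old + sum rest   ≡⟨ sum-++ old rest ⟨
    sum (old ++ rest)    ≡⟨ sum-↭ σ ⟨
    sum λs               ≡⟨ total ⟩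
    n                    ∎
  restNonZero : NonZero (weight f rest)
  restNonZero = m*n≢0⇒n≢0 (weight f old)
    ⦃ >-nonZero (subst (1 ≤_) oldWeight (1≤weight-maximal {λs = λs} f1 maximal)) ⦄

∈⇒↭-∷ : ∀ {x : ℕ} {xs} → x ∈ xs → ∃ λ ys → xs ↭ x ∷ ys
∈⇒↭-∷ {xs = _ ∷ ys} (here refl) = ys , ↭-refl
∈⇒↭-∷ {xs = y ∷ _}  (there x∈)  with ys , σ ← ∈⇒↭-∷ x∈ =
  y ∷ ys , ↭-trans (↭-prep y σ) (↭-swap y _ ↭-refl)

∈-↭-∷-≢ : ∀ {x y : ℕ} {xs ys} → y ∈ xs → xs ↭ x ∷ ys → x ≢ y → y ∈ ys
∈-↭-∷-≢ y∈xs σ x≢y with ∈-resp-↭ σ y∈xs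
... | here y≡x   = contradiction (sym y≡x) x≢y
... | there y∈ys = y∈ys

maximal-part-optimal : ∀ {f n λs x new} → 1 ≤ f 1 → IsPartition n λs → IsMaximal f n λs →
                       x ∈ λs → Decomposes x new → weight f new ≤ f x
maximal-part-optimal {f} {x = x} {new} f1 part maximal x∈λs (posNew , sumNew)
  with rest , σ ← ∈⇒↭-∷ x∈λs =
  subst (weight f new ≤_) (*-identityʳ (f x))
        (exchange f1 part maximal {old = x ∷ []} σ (posNew , trans sumNew (sym (+-identityʳ x))))

maximal-pair-optimal : ∀ {f n λs a b new} → 1 ≤ f 1 → IsPartition n λs → IsMaximal f n λs →
                       a ∈ λs → b ∈ λs → a ≢ b → Decomposes (a + b) new →
                       weight f new ≤ f a * f b
maximal-pair-optimal {f} {a = a} {b} {new} f1 part maximal a∈λs b∈λs a≢b (posNew , sumNew)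
  with rest , σ ← ∈⇒↭-∷ a∈λs
  with rest′ , τ ← ∈⇒↭-∷ (∈-↭-∷-≢ b∈λs σ a≢b) =
  subst (weight f new ≤_) (cong (f a *_) (*-identityʳ (f b)))
        (exchange f1 part maximal {old = a ∷ b ∷ []} (↭-trans σ (↭-prep a τ))
                  (posNew , trans sumNew (cong (a +_) (sym (+-identityʳ b)))))

count≢0⇒Any : ∀ {P : ℕ → Set} (P? : ∀ x → Dec (P x)) xs → count P? xs ≢ 0 → Any P xs
count≢0⇒Any P? []       c≢0 = contradiction refl c≢0
count≢0⇒Any P? (x ∷ xs) c≢0 with P? x
... | yes px = here px
... | no  _  = there (count≢0⇒Any P? xs c≢0)

mult≡1⇒∈ : ∀ {x xs} → mult x xs ≡ 1 → x ∈ xs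
mult≡1⇒∈ {x} {xs} m≡1 = count≢0⇒Any (x ≟_) xs (λ m≡0 → 1+n≢0 (trans (sym m≡1) m≡0))

∑< : ℕ → (ℕ → ℕ) → ℕ
∑< zero    g = 0
∑< (suc n) g = ∑< n g + g n

syntax ∑< n (λ j → e) = ∑[ j < n ] e

∑-cong : ∀ {g h} n → (∀ {j} → j < n → g j ≡ h j) → ∑< n g ≡ ∑< n h
∑-cong zero    eq = refl
∑-cong (suc n) eq = cong₂ _+_ (∑-cong n (eq ∘ m<n⇒m<1+n)) (eq ≤-refl)

∑-monoʳ : ∀ {g h} n → (∀ {j} → j < n → g j ≤ h j) → ∑< n g ≤ ∑< n h
∑-monoʳ zero    le = z≤n
∑-monoʳ (suc n) le = +-mono-≤ (∑-monoʳ n (le ∘ m<n⇒m<1+n)) (le ≤-refl)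

∑-monoˡ : ∀ g {m n} → m ≤ n → ∑< m g ≤ ∑< n g
∑-monoˡ g {n = zero}  z≤n = z≤n
∑-monoˡ g {m} {suc n} m≤1+n with m≤n⇒m<n∨m≡n m≤1+n
... | inj₁ m<1+n = ≤-trans (∑-monoˡ g (≤-pred m<1+n)) (m≤m+n (∑< n g) (g n))
... | inj₂ refl  = ≤-refl

∑-*ʳ : ∀ g c n → ∑< n g * c ≡ ∑[ j < n ] (g j * c)
∑-*ʳ g c zero    = refl
∑-*ʳ g c (suc n) = trans (*-distribʳ-+ c (∑< n g) (g n)) (cong (_+ g n * c) (∑-*ʳ g c n))

∑-shift : ∀ g n → ∑< (suc n) g ≡ g 0 + ∑< n (g ∘ suc)
∑-shift g zero    = +-comm 0 (g 0)
∑-shift g (suc n) = begin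
  ∑< (suc n) g + g (suc n)           ≡⟨ cong (_+ g (suc n)) (∑-shift g n) ⟩
  g 0 + ∑< n (g ∘ suc) + g (suc n)   ≡⟨ +-assoc (g 0) _ _ ⟩
  g 0 + ∑< (suc n) (g ∘ suc)         ∎
  where open ≡-Reasoning

sum-map-upTo : ∀ g n → sum (map g (upTo n)) ≡ ∑< n g
sum-map-upTo g zero    = refl
sum-map-upTo g (suc n) = begin
  sum (map g (upTo (suc n)))         ≡⟨ cong (sum ∘ map g) (upTo-∷ʳ n) ⟨
  sum (map g (upTo n ++ [ n ]))      ≡⟨ cong sum (map-++ g (upTo n) [ n ]) ⟩
  sum (map g (upTo n) ++ [ g n ])    ≡⟨ sum-++ (map g (upTo n)) [ g n ] ⟩
  sum (map g (upTo n)) + (g n + 0)   ≡⟨ cong₂ _+_ (sum-map-upTo g n) (+-identityʳ (g n)) ⟩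
  ∑< n g + g n                       ∎
  where open ≡-Reasoning

-- Counting partitions into bounded parts

length-concatMap : ∀ {A B : Set} (g : A → List B) xs →
                   length (concatMap g xs) ≡ sum (map (length ∘ g) xs)
length-concatMap g []       = refl
length-concatMap g (x ∷ xs) =
  trans (length-++ (g x)) (cong (length (g x) +_) (length-concatMap g xs))

filter-upTo : ∀ k n → filter (λ j → suc j ≤? k) (upTo n) ≡ upTo (n ⊓ k)
filter-upTo k zero    = refl
filter-upTo k (suc n) = begin
  filter P? (upTo (suc n))                ≡⟨ cong (filter P?) (upTo-∷ʳ n) ⟨
  filter P? (upTo n ++ [ n ])             ≡⟨ filter-++ P? (upTo n) [ n ] ⟩
  filter P? (upTo n) ++ filter P? [ n ]   ≡⟨ cong (_++ filter P? [ n ]) (filter-upTo k n) ⟩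
  upTo (n ⊓ k) ++ filter P? [ n ]         ≡⟨ lastStep ⟩
  upTo (suc n ⊓ k)                        ∎
  where
  open ≡-Reasoning
  P? = λ j → suc j ≤? k
  lastStep : upTo (n ⊓ k) ++ filter P? [ n ] ≡ upTo (suc n ⊓ k)
  lastStep with suc n ≤? k
  ... | yes n<k = begin
    upTo (n ⊓ k) ++ filter P? [ n ]
      ≡⟨ cong₂ _++_ (cong upTo (m≤n⇒m⊓n≡m (<⇒≤ n<k))) (filter-accept P? n<k) ⟩
    upTo n ++ [ n ]    ≡⟨ upTo-∷ʳ n ⟩
    upTo (suc n)       ≡⟨ cong upTo (m≤n⇒m⊓n≡m n<k) ⟨
    upTo (suc n ⊓ k)   ∎
  ... | no n≮k = begin
    upTo (n ⊓ k) ++ filter P? [ n ]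
      ≡⟨ cong₂ _++_ (cong upTo (m≥n⇒m⊓n≡n k≤n)) (filter-reject P? n≮k) ⟩
    upTo k ++ []       ≡⟨ ++-identityʳ (upTo k) ⟩
    upTo k             ≡⟨ cong upTo (m≥n⇒m⊓n≡n (m≤n⇒m≤1+n k≤n)) ⟨
    upTo (suc n ⊓ k)   ∎
    where k≤n = ≤-pred (≰⇒> n≮k)

length-partsFuel-suc : ∀ f m k →
  length (partsFuel (suc f) (suc m) k) ≡ ∑[ j < suc m ⊓ k ] length (partsFuel f (m ∸ j) (suc j))
length-partsFuel-suc f m k = begin
  length (concatMap g (filter (λ j → suc j ≤? k) (filter (λ j → suc j ≤? suc m) (upTo (suc m)))))
    ≡⟨ cong (λ xs → length (concatMap g (filter (λ j → suc j ≤? k) xs))) allBelow ⟩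
  length (concatMap g (filter (λ j → suc j ≤? k) (upTo (suc m))))
    ≡⟨ cong (length ∘ concatMap g) (filter-upTo k (suc m)) ⟩
  length (concatMap g (upTo (suc m ⊓ k)))
    ≡⟨ length-concatMap g (upTo (suc m ⊓ k)) ⟩
  sum (map (length ∘ g) (upTo (suc m ⊓ k)))
    ≡⟨ sum-map-upTo (length ∘ g) (suc m ⊓ k) ⟩
  ∑< (suc m ⊓ k) (length ∘ g)
    ≡⟨ ∑-cong (suc m ⊓ k) (λ {j} _ → length-map (suc j ∷_) (partsFuel f (m ∸ j) (suc j))) ⟩
  ∑[ j < suc m ⊓ k ] length (partsFuel f (m ∸ j) (suc j)) ∎
  where
  open ≡-Reasoning
  g : ℕ → List (List ℕ)
  g j = map (suc j ∷_) (partsFuel f (m ∸ j) (suc j))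
  allBelow : filter (λ j → suc j ≤? suc m) (upTo (suc m)) ≡ upTo (suc m)
  allBelow = trans (filter-upTo (suc m) (suc m)) (cong upTo (⊓-idem (suc m)))

-- B dominates the recurrence satisfied by c · v^m · #(partitions of m into parts ≤ k).
record IsMajorant (v c : ℕ) (B : ℕ → ℕ → ℕ) : Set where
  field
    base : ∀ k → c ≤ B 0 k
    step : ∀ m k → ∑[ j < suc m ⊓ k ] (B (m ∸ j) (suc j) * v ^ suc j) ≤ B (suc m) k

length-partsFuel≤majorant : ∀ {v c B} → IsMajorant v c B →
  ∀ f m k → length (partsFuel f m k) * v ^ m * c ≤ B m k
length-partsFuel≤majorant major zero    zero    k =
  ≤-trans (≤-reflexive (*-identityˡ _)) (IsMajorant.base major k)
length-partsFuel≤majorant major (suc f) zero    k =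
  ≤-trans (≤-reflexive (*-identityˡ _)) (IsMajorant.base major k)
length-partsFuel≤majorant major zero    (suc m) k = z≤n
length-partsFuel≤majorant {v} {c} {B} major (suc f) (suc m) k = begin
  length (partsFuel (suc f) (suc m) k) * v ^ suc m * c
    ≡⟨ cong (λ l → l * v ^ suc m * c) (length-partsFuel-suc f m k) ⟩
  ∑< n p * v ^ suc m * c
    ≡⟨ trans (cong (_* c) (∑-*ʳ p (v ^ suc m) n)) (∑-*ʳ _ c n) ⟩
  ∑[ j < n ] (p j * v ^ suc m * c)
    ≤⟨ ∑-monoʳ n term ⟩
  ∑[ j < n ] (B (m ∸ j) (suc j) * v ^ suc j)
    ≤⟨ IsMajorant.step major m k ⟩
  B (suc m) k ∎
  where
  open ≤-Reasoning
  n = suc m ⊓ k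
  p : ℕ → ℕ
  p j = length (partsFuel f (m ∸ j) (suc j))
  regroup : ∀ a x y z → a * (x * y) * z ≡ a * x * z * y
  regroup = solve 4 (λ a x y z → a :* (x :* y) :* z := a :* x :* z :* y) refl
  term : ∀ {j} → j < n → p j * v ^ suc m * c ≤ B (m ∸ j) (suc j) * v ^ suc j
  term {j} j<n = begin
    p j * v ^ suc m * c
      ≡⟨ cong (λ e → p j * v ^ e * c) (m∸n+n≡m (≤-trans j<n (m⊓n≤m (suc m) k))) ⟨
    p j * v ^ (m ∸ j + suc j) * c
      ≡⟨ cong (λ x → p j * x * c) (^-distribˡ-+-* v (m ∸ j) (suc j)) ⟩
    p j * (v ^ (m ∸ j) * v ^ suc j) * c
      ≡⟨ regroup (p j) (v ^ (m ∸ j)) (v ^ suc j) c ⟩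
    p j * v ^ (m ∸ j) * c * v ^ suc j
      ≤⟨ *-monoˡ-≤ (v ^ suc j) (length-partsFuel≤majorant major f (m ∸ j) (suc j)) ⟩
    B (m ∸ j) (suc j) * v ^ suc j ∎

count'≤length : ∀ {P : List ℕ → Set} (P? : ∀ xs → Dec (P xs)) xss → count' P? xss ≤ length xss
count'≤length P? []         = z≤n
count'≤length P? (xs ∷ xss) with does (P? xs)
... | true  = s≤s (count'≤length P? xss)
... | false = m≤n⇒m≤1+n (count'≤length P? xss)

N03≤length-partitions : ∀ m → N03 m ≤ length (partitions m)
N03≤length-partitions m = count'≤length rank3? (partitions m)

-- The partition numbers, by dynamic programming

lookupOr : ∀ {A : Set} → A → List A → ℕ → A
lookupOr d []       _       = d
lookupOr d (x ∷ _)  zero    = x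
lookupOr d (_ ∷ xs) (suc i) = lookupOr d xs i

lookupOr-beyond : ∀ {A : Set} (d : A) xs {i} → length xs ≤ i → lookupOr d xs i ≡ d
lookupOr-beyond d []       _           = refl
lookupOr-beyond d (_ ∷ xs) (s≤s len≤i) = lookupOr-beyond d xs len≤i

lookupOr-All : ∀ {A : Set} {P : A → Set} {d} xs i → P d → All P xs → P (lookupOr d xs i)
lookupOr-All []       i       pd []        = pd
lookupOr-All (x ∷ xs) zero    pd (px ∷ _)  = px
lookupOr-All (x ∷ xs) (suc i) pd (_ ∷ pxs) = lookupOr-All xs i pd pxs

partialSums : ℕ → List ℕ → List ℕ
partialSums a []       = a ∷ []
partialSums a (x ∷ xs) = a ∷ partialSums (a + x) xs

lookupOr-partialSums : ∀ (g h : ℕ → ℕ) a {N n} → n ≤ N →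
  lookupOr 0 (partialSums a (map g (applyUpTo h N))) n ≡ a + ∑[ j < n ] g (h j)
lookupOr-partialSums g h a {zero}  {zero}  _         = sym (+-identityʳ a)
lookupOr-partialSums g h a {suc N} {zero}  _         = sym (+-identityʳ a)
lookupOr-partialSums g h a {suc N} {suc n} (s≤s n≤N) = begin
  lookupOr 0 (partialSums (a + g (h 0)) (map g (applyUpTo (h ∘ suc) N))) n
    ≡⟨ lookupOr-partialSums g (h ∘ suc) (a + g (h 0)) n≤N ⟩
  a + g (h 0) + ∑[ j < n ] g (h (suc j))
    ≡⟨ +-assoc a _ _ ⟩
  a + (g (h 0) + ∑[ j < n ] g (h (suc j)))
    ≡⟨ cong (a +_) (∑-shift (g ∘ h) n) ⟨
  a + ∑[ j < suc n ] g (h j) ∎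
  where open ≡-Reasoning

-- partitionRows m = row m ∷ … ∷ row 0, where entry k ≤ r of row r is the number of
-- partitions of r into parts ≤ k, computed by summing over the largest part.
-- extendRows takes the earlier rows as an argument so that evaluation shares them.
nextRow : ℕ → List (List ℕ) → List ℕ
nextRow m rows =
  partialSums 0 (map (λ j → lookupOr 0 (lookupOr [] rows j) (suc j ⊓ (m ∸ j))) (upTo (suc m)))

extendRows : ℕ → List (List ℕ) → List (List ℕ)
extendRows m rows = nextRow m rows ∷ rows

partitionRows : ℕ → List (List ℕ)
partitionRows zero    = (1 ∷ []) ∷ []
partitionRows (suc m) = extendRows m (partitionRows m)

partitionCount : ℕ → ℕ → ℕ
partitionCount m k = lookupOr 0 (lookupOr [] (partitionRows m) 0) (k ⊓ m)

lookupOr-partitionRows : ∀ {m j} → j ≤ m →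
  lookupOr [] (partitionRows m) j ≡ lookupOr [] (partitionRows (m ∸ j)) 0
lookupOr-partitionRows {m}     {zero}  _         = refl
lookupOr-partitionRows {suc m} {suc j} (s≤s j≤m) = lookupOr-partitionRows j≤m

partitionCount-suc : ∀ m k →
  partitionCount (suc m) k ≡ ∑[ j < suc m ⊓ k ] partitionCount (m ∸ j) (suc j)
partitionCount-suc m k = begin
  lookupOr 0 (nextRow m (partitionRows m)) (k ⊓ suc m)
    ≡⟨ lookupOr-partialSums _ (λ j → j) 0 (m⊓n≤n k (suc m)) ⟩
  ∑[ j < k ⊓ suc m ] lookupOr 0 (lookupOr [] (partitionRows m) j) (suc j ⊓ (m ∸ j))
    ≡⟨ ∑-cong (k ⊓ suc m) sameRow ⟩
  ∑[ j < k ⊓ suc m ] partitionCount (m ∸ j) (suc j)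
    ≡⟨ cong (λ n → ∑< n _) (⊓-comm k (suc m)) ⟩
  ∑[ j < suc m ⊓ k ] partitionCount (m ∸ j) (suc j) ∎
  where
  open ≡-Reasoning
  sameRow : ∀ {j} → j < k ⊓ suc m →
    lookupOr 0 (lookupOr [] (partitionRows m) j) (suc j ⊓ (m ∸ j)) ≡ partitionCount (m ∸ j) (suc j)
  sameRow {j} j<n = cong (λ row → lookupOr 0 row (suc j ⊓ (m ∸ j)))
                         (lookupOr-partitionRows (≤-pred (≤-trans j<n (m⊓n≤n k (suc m)))))

partitionCount-isMajorant : IsMajorant 1 1 partitionCount
partitionCount-isMajorant = record { base = base ; step = step }
  where
  base : ∀ k → 1 ≤ partitionCount 0 k
  base k rewrite ⊓-zeroʳ k = ≤-refl
  step : ∀ m k →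
    ∑[ j < suc m ⊓ k ] (partitionCount (m ∸ j) (suc j) * 1 ^ suc j) ≤ partitionCount (suc m) k
  step m k = ≤-reflexive (trans (∑-cong (suc m ⊓ k) drop-1^) (sym (partitionCount-suc m k)))
    where
    drop-1^ : ∀ {j} → j < suc m ⊓ k →
      partitionCount (m ∸ j) (suc j) * 1 ^ suc j ≡ partitionCount (m ∸ j) (suc j)
    drop-1^ {j} _ =
      trans (cong (partitionCount (m ∸ j) (suc j) *_) (^-zeroˡ (suc j))) (*-identityʳ _)

length-partsFuel≤partitionCount : ∀ f m k → length (partsFuel f m k) ≤ partitionCount m k
length-partsFuel≤partitionCount f m k = begin
  length (partsFuel f m k)               ≡⟨ *-identityʳ _ ⟨
  length (partsFuel f m k) * 1           ≡⟨ cong (length (partsFuel f m k) *_) (^-zeroˡ m) ⟨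
  length (partsFuel f m k) * 1 ^ m       ≡⟨ *-identityʳ _ ⟨
  length (partsFuel f m k) * 1 ^ m * 1
    ≤⟨ length-partsFuel≤majorant partitionCount-isMajorant f m k ⟩
  partitionCount m k                     ∎
  where open ≤-Reasoning

-- An exponential bound for the partition numbers

-- G k / scale bounds ∏_{j ≤ k} (1 - (5/6)^j)⁻¹: for 2 ≤ k < 20, G k is the least integer
-- with ∑_{1 ≤ i ≤ k} G i (5/6)^i ≤ G k, i.e. weightedSum k ≤ G k · 6^k, and the constant
-- value G∞ beyond 20 is large enough for this inequality to propagate (weightedSum-tail).
scale : ℕ
scale = 1000000

G∞ : ℕ
G∞ = 196983446

growthTable : List ℕ
growthTable =
  1000000 ∷ 1000000 ∷ 2727273 ∷ 6473527 ∷ 12503266 ∷ 20904192 ∷ 31430053 ∷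
  43597244 ∷ 56809263 ∷ 70466056 ∷ 84038790 ∷ 97108416 ∷ 109375620 ∷ 120652247 ∷
  130843172 ∷ 139925075 ∷ 147926086 ∷ 154908305 ∷ 160953901 ∷ 166154686 ∷ []

G : ℕ → ℕ
G = lookupOr G∞ growthTable

scale≤G : ∀ k → scale ≤ G k
scale≤G k = lookupOr-All growthTable k (byDecision (scale ≤? G∞) refl)
                                       (byDecision (all? (scale ≤?_) growthTable) refl)

G-beyond : ∀ {k} → 20 ≤ k → G k ≡ G∞
G-beyond = lookupOr-beyond G∞ growthTable

weightedTerm : ℕ → ℕ → ℕ
weightedTerm k j = G (suc j) * 5 ^ suc j * 6 ^ (k ∸ suc j)

weightedSum : ℕ → ℕ
weightedSum k = ∑< k (weightedTerm k)

weightedSum-suc : ∀ k → weightedSum (suc k) ≡ weightedSum k * 6 + G (suc k) * 5 ^ suc k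
weightedSum-suc k = begin
  ∑< k (weightedTerm (suc k)) + weightedTerm (suc k) k
    ≡⟨ cong₂ _+_ (∑-cong k shift) (cong (λ e → G (suc k) * 5 ^ suc k * 6 ^ e) (n∸n≡0 k)) ⟩
  ∑[ j < k ] (weightedTerm k j * 6) + G (suc k) * 5 ^ suc k * 1
    ≡⟨ cong₂ _+_ (∑-*ʳ (weightedTerm k) 6 k) (sym (*-identityʳ _)) ⟨
  weightedSum k * 6 + G (suc k) * 5 ^ suc k ∎
  where
  open ≡-Reasoning
  regroup : ∀ g q → g * (6 * q) ≡ g * q * 6
  regroup = solve 2 (λ g q → g :* (con 6 :* q) := g :* q :* con 6) refl
  shift : ∀ {j} → j < k → weightedTerm (suc k) j ≡ weightedTerm k j * 6
  shift {j} j<k = begin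
    G (suc j) * 5 ^ suc j * 6 ^ (k ∸ j)
      ≡⟨ cong (λ e → G (suc j) * 5 ^ suc j * 6 ^ e) (+-∸-assoc 1 j<k) ⟩
    G (suc j) * 5 ^ suc j * (6 * 6 ^ (k ∸ suc j))
      ≡⟨ regroup (G (suc j) * 5 ^ suc j) (6 ^ (k ∸ suc j)) ⟩
    weightedTerm k j * 6 ∎

weightedSum-tail-step : ∀ e g p q → e + g * p ≤ q → e * 6 + g * p + g * (5 * p) ≤ q * 6
weightedSum-tail-step e g p q e+gp≤q = begin
  e * 6 + g * p + g * (5 * p)   ≡⟨ regroup e g p ⟩
  (e + g * p) * 6               ≤⟨ *-monoˡ-≤ 6 e+gp≤q ⟩
  q * 6                         ∎
  where
  open ≤-Reasoning
  regroup : ∀ e g p → e * 6 + g * p + g * (5 * p) ≡ (e + g * p) * 6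
  regroup = solve 3 (λ e g p → e :* con 6 :+ g :* p :+ g :* (con 5 :* p) := (e :+ g :* p) :* con 6)
                    refl

weightedSum-tail : ∀ d → weightedSum (d + 20) + G∞ * 5 ^ suc (d + 20) ≤ G∞ * 6 ^ (d + 20)
weightedSum-tail zero    = byDecision (weightedSum 20 + G∞ * 5 ^ 21 ≤? G∞ * 6 ^ 20) refl
weightedSum-tail (suc d) =
  subst₂ _≤_ lhs rhs
    (weightedSum-tail-step (weightedSum k) G∞ (5 ^ suc k) (G∞ * 6 ^ k) (weightedSum-tail d))
  where
  k = d + 20
  lhs : weightedSum k * 6 + G∞ * 5 ^ suc k + G∞ * (5 * 5 ^ suc k)
      ≡ weightedSum (suc k) + G∞ * 5 ^ suc (suc k)
  lhs = cong (_+ G∞ * 5 ^ suc (suc k)) (sym (trans (weightedSum-suc k)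
          (cong (λ g → weightedSum k * 6 + g * 5 ^ suc k) (G-beyond {suc k} (m≤n+m 20 (suc d))))))
  rhs : G∞ * 6 ^ k * 6 ≡ G∞ * 6 ^ suc k
  rhs = trans (*-assoc G∞ (6 ^ k) 6) (cong (G∞ *_) (*-comm (6 ^ k) 6))

weightedSum≤ : ∀ k → weightedSum k ≤ G k * 6 ^ k
weightedSum≤ k with k <? 20
... | yes k<20 = byDecision (allUpTo? (λ k → weightedSum k ≤? G k * 6 ^ k) 20) refl k<20
... | no  k≮20 = subst (λ k → weightedSum k ≤ G k * 6 ^ k) (m∸n+n≡m (≮⇒≥ k≮20)) (begin
  weightedSum (d + 20)                           ≤⟨ m≤m+n (weightedSum (d + 20)) _ ⟩
  weightedSum (d + 20) + G∞ * 5 ^ suc (d + 20)   ≤⟨ weightedSum-tail d ⟩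
  G∞ * 6 ^ (d + 20)
    ≡⟨ cong (_* 6 ^ (d + 20)) (G-beyond {d + 20} (m≤n+m 20 d)) ⟨
  G (d + 20) * 6 ^ (d + 20)                      ∎)
  where
  open ≤-Reasoning
  d = k ∸ 20

exponentialMajorant : IsMajorant 5 scale (λ m k → G k * 6 ^ m)
exponentialMajorant = record { base = base ; step = step }
  where
  base : ∀ k → scale ≤ G k * 6 ^ 0
  base k = subst (scale ≤_) (sym (*-identityʳ (G k))) (scale≤G k)

  exponents : ∀ m k {j} → j < suc m ⊓ k → m ∸ j + k ≡ k ∸ suc j + suc m
  exponents m k {j} j<n = begin
    m ∸ j + k                       ≡⟨ cong (m ∸ j +_) (m∸n+n≡m (≤-trans j<n (m⊓n≤n (suc m) k))) ⟨
    m ∸ j + (k ∸ suc j + suc j)     ≡⟨ +-comm (m ∸ j) (k ∸ suc j + suc j) ⟩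
    k ∸ suc j + suc j + (m ∸ j)     ≡⟨ +-assoc (k ∸ suc j) (suc j) (m ∸ j) ⟩
    k ∸ suc j + (suc j + (m ∸ j))   ≡⟨ cong (k ∸ suc j +_) (+-comm (suc j) (m ∸ j)) ⟩
    k ∸ suc j + (m ∸ j + suc j)
      ≡⟨ cong (k ∸ suc j +_) (m∸n+n≡m (≤-trans j<n (m⊓n≤m (suc m) k))) ⟩
    k ∸ suc j + suc m               ∎
    where open ≡-Reasoning

  regroup : ∀ m k {j} → j < suc m ⊓ k →
    G (suc j) * 6 ^ (m ∸ j) * 5 ^ suc j * 6 ^ k ≡ weightedTerm k j * 6 ^ suc m
  regroup m k {j} j<n = begin
    G (suc j) * 6 ^ (m ∸ j) * 5 ^ suc j * 6 ^ k
      ≡⟨ swap (G (suc j)) (6 ^ (m ∸ j)) (5 ^ suc j) (6 ^ k) ⟩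
    G (suc j) * 5 ^ suc j * (6 ^ (m ∸ j) * 6 ^ k)
      ≡⟨ cong (G (suc j) * 5 ^ suc j *_) (^-distribˡ-+-* 6 (m ∸ j) k) ⟨
    G (suc j) * 5 ^ suc j * 6 ^ (m ∸ j + k)
      ≡⟨ cong (λ e → G (suc j) * 5 ^ suc j * 6 ^ e) (exponents m k j<n) ⟩
    G (suc j) * 5 ^ suc j * 6 ^ (k ∸ suc j + suc m)
      ≡⟨ cong (G (suc j) * 5 ^ suc j *_) (^-distribˡ-+-* 6 (k ∸ suc j) (suc m)) ⟩
    G (suc j) * 5 ^ suc j * (6 ^ (k ∸ suc j) * 6 ^ suc m)
      ≡⟨ *-assoc (G (suc j) * 5 ^ suc j) (6 ^ (k ∸ suc j)) (6 ^ suc m) ⟨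
    weightedTerm k j * 6 ^ suc m ∎
    where
    open ≡-Reasoning
    swap : ∀ g a b c → g * a * b * c ≡ g * b * (a * c)
    swap = solve 4 (λ g a b c → g :* a :* b :* c := g :* b :* (a :* c)) refl

  step : ∀ m k → ∑[ j < suc m ⊓ k ] (G (suc j) * 6 ^ (m ∸ j) * 5 ^ suc j) ≤ G k * 6 ^ suc m
  step m k = *-cancelʳ-≤ (∑< n term) (G k * 6 ^ suc m) (6 ^ k) ⦃ m^n≢0 6 k ⦄ (begin
    ∑< n term * 6 ^ k                          ≡⟨ ∑-*ʳ term (6 ^ k) n ⟩
    ∑[ j < n ] (term j * 6 ^ k)                ≡⟨ ∑-cong n (regroup m k) ⟩
    ∑[ j < n ] (weightedTerm k j * 6 ^ suc m)  ≡⟨ ∑-*ʳ (weightedTerm k) (6 ^ suc m) n ⟨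
    ∑< n (weightedTerm k) * 6 ^ suc m
      ≤⟨ *-monoˡ-≤ (6 ^ suc m) (∑-monoˡ (weightedTerm k) (m⊓n≤n (suc m) k)) ⟩
    weightedSum k * 6 ^ suc m                  ≤⟨ *-monoˡ-≤ (6 ^ suc m) (weightedSum≤ k) ⟩
    G k * 6 ^ k * 6 ^ suc m                    ≡⟨ swap (G k) (6 ^ k) (6 ^ suc m) ⟩
    G k * 6 ^ suc m * 6 ^ k                    ∎)
    where
    open ≤-Reasoning
    n = suc m ⊓ k
    term : ℕ → ℕ
    term j = G (suc j) * 6 ^ (m ∸ j) * 5 ^ suc j
    swap : ∀ g a b → g * a * b ≡ g * b * a
    swap = solve 3 (λ g a b → g :* a :* b := g :* b :* a) refl

N03-exponential : ∀ {a} → 20 ≤ a → N03 a * 5 ^ a * scale ≤ G∞ * 6 ^ a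
N03-exponential {a} 20≤a = begin
  N03 a * 5 ^ a * scale
    ≤⟨ *-monoˡ-≤ scale (*-monoˡ-≤ (5 ^ a) (N03≤length-partitions a)) ⟩
  length (partitions a) * 5 ^ a * scale
    ≤⟨ length-partsFuel≤majorant exponentialMajorant a a a ⟩
  G a * 6 ^ a
    ≡⟨ cong (_* 6 ^ a) {G a} {G∞} (G-beyond {a} 20≤a) ⟩
  G∞ * 6 ^ a ∎
  where open ≤-Reasoning

-- Decompositions into admissible parts

admissibleParts : List ℕ
admissibleParts = 1 ∷ 3 ∷ 4 ∷ 6 ∷ 7 ∷ 9 ∷ 10 ∷ 13 ∷ 16 ∷ []

pattern 7+_ n = suc (suc (suc (suc (suc (suc (suc n))))))

decomposition : ℕ → List ℕ
decomposition 0  = []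
decomposition 1  = 1 ∷ []
decomposition 2  = 1 ∷ 1 ∷ []
decomposition 3  = 3 ∷ []
decomposition 4  = 4 ∷ []
decomposition 5  = 4 ∷ 1 ∷ []
decomposition 6  = 6 ∷ []
decomposition 7  = 7 ∷ []
decomposition 8  = 4 ∷ 4 ∷ []
decomposition 9  = 9 ∷ []
decomposition 10 = 10 ∷ []
decomposition 11 = 7 ∷ 4 ∷ []
decomposition 12 = 4 ∷ 4 ∷ 4 ∷ []
decomposition 13 = 13 ∷ []
decomposition (7+ n) = 7 ∷ decomposition n

positive : ∀ {xs} → {True (all? (1 ≤?_) xs)} → Positive xs
positive {xs} {p} = toWitness p

decomposition-decomposes : ∀ n → Decomposes n (decomposition n)
decomposition-decomposes 0  = positive , refl
decomposition-decomposes 1  = positive , refl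
decomposition-decomposes 2  = positive , refl
decomposition-decomposes 3  = positive , refl
decomposition-decomposes 4  = positive , refl
decomposition-decomposes 5  = positive , refl
decomposition-decomposes 6  = positive , refl
decomposition-decomposes 7  = positive , refl
decomposition-decomposes 8  = positive , refl
decomposition-decomposes 9  = positive , refl
decomposition-decomposes 10 = positive , refl
decomposition-decomposes 11 = positive , refl
decomposition-decomposes 12 = positive , refl
decomposition-decomposes 13 = positive , refl
decomposition-decomposes (7+ 7+ n) with pos , total ← decomposition-decomposes (7+ n) =
  s≤s z≤n ∷ pos , cong (7 +_) total

decomposition-+7 : ∀ {a} → 7 ≤ a → decomposition (7 + a) ≡ 7 ∷ decomposition a
decomposition-+7 7≤a with _ , refl ← m≤n⇒∃[o]m+o≡n 7≤a = refl

Improvable : ℕ → Set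
Improvable x = N03 x < N03P (decomposition x)

classify-small : ∀ {x} → x < 34 → 1 ≤ x → x ∈ admissibleParts ⊎ Improvable x
classify-small = byDecision (allUpTo? admissibleOrImprovable? 34) refl
  where
  admissibleOrImprovable? : ∀ x → Dec (1 ≤ x → x ∈ admissibleParts ⊎ Improvable x)
  admissibleOrImprovable? x =
    1 ≤? x →-dec (x ∈? admissibleParts ⊎-dec N03 x <? N03P (decomposition x))

improvable-medium : ∀ {x} → x < 56 → 34 ≤ x → Improvable x
improvable-medium {x} x<56 34≤x = begin-strict
  N03 x                    ≤⟨ N03≤length-partitions x ⟩
  length (partitions x)    ≤⟨ length-partsFuel≤partitionCount x x x ⟩
  partitionCount x x       <⟨ countBelow x<56 34≤x ⟩
  N03P (decomposition x)   ∎
  where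
  open ≤-Reasoning
  countBelow : ∀ {x} → x < 56 → 34 ≤ x → partitionCount x x < N03P (decomposition x)
  countBelow = byDecision
    (allUpTo? (λ x → 34 ≤? x →-dec partitionCount x x <? N03P (decomposition x)) 56) refl

-- A record with the constants as parameters: Agda normalises the field types of a
-- record, which with the numeral G∞ in place of g would take unary time.
record Outgrows (g s a : ℕ) : Set where
  constructor outgrowsBy
  field
    bound : g * 6 ^ a < N03P (decomposition a) * 5 ^ a * s

outgrows? : ∀ g s a → Dec (Outgrows g s a)
outgrows? g s a = map′ outgrowsBy Outgrows.bound (g * 6 ^ a <? N03P (decomposition a) * 5 ^ a * s)

outgrows-+7 : ∀ {g s a} → 7 ≤ a → Outgrows g s a → Outgrows g s (7 + a)
outgrows-+7 {g} {s} {a} 7≤a (outgrowsBy bound) = outgrowsBy (begin-strict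
  g * 6 ^ (7 + a)                  ≡⟨ cong (g *_) (^-distribˡ-+-* 6 7 a) ⟩
  g * (6 ^ 7 * 6 ^ a)              ≡⟨ x∙yz≈y∙xz g (6 ^ 7) (6 ^ a) ⟩
  6 ^ 7 * (g * 6 ^ a)              <⟨ *-monoʳ-< (6 ^ 7) bound ⟩
  6 ^ 7 * (w * 5 ^ a * s)
    ≤⟨ *-monoˡ-≤ (w * 5 ^ a * s) (byDecision (6 ^ 7 ≤? N03 7 * 5 ^ 7) refl) ⟩
  N03 7 * 5 ^ 7 * (w * 5 ^ a * s)  ≡⟨ regroup (N03 7) (5 ^ 7) w (5 ^ a) s ⟩
  N03 7 * w * (5 ^ 7 * 5 ^ a) * s  ≡⟨ cong (λ p → N03 7 * w * p * s) (^-distribˡ-+-* 5 7 a) ⟨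
  N03P (7 ∷ decomposition a) * 5 ^ (7 + a) * s
    ≡⟨ cong (λ parts → N03P parts * 5 ^ (7 + a) * s) (decomposition-+7 7≤a) ⟨
  N03P (decomposition (7 + a)) * 5 ^ (7 + a) * s ∎)
  where
  open ≤-Reasoning
  w = N03P (decomposition a)
  regroup : ∀ c p w q s → c * p * (w * q * s) ≡ c * w * (p * q) * s
  regroup = solve 5 (λ c p w q s → c :* p :* (w :* q :* s) := c :* w :* (p :* q) :* s) refl

outgrows-56+ : ∀ q {r} → r < 7 → Outgrows G∞ scale (q * 7 + (56 + r))
outgrows-56+ zero        r<7 = byDecision (allUpTo? (λ r → outgrows? G∞ scale (56 + r)) 7) refl r<7
outgrows-56+ (suc q) {r} r<7 =
  outgrows-+7 (≤-trans (m≤m+n 7 (49 + r)) (m≤n+m (56 + r) (q * 7))) (outgrows-56+ q r<7)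

outgrows : ∀ {a} → 56 ≤ a → Outgrows G∞ scale a
outgrows {a} 56≤a = subst (Outgrows G∞ scale) a≡ (outgrows-56+ q (m%n<n (a ∸ 56) 7))
  where
  q = (a ∸ 56) / 7
  r = (a ∸ 56) % 7
  a≡ : q * 7 + (56 + r) ≡ a
  a≡ = begin
    q * 7 + (56 + r)   ≡⟨ +-comm (q * 7) (56 + r) ⟩
    56 + r + q * 7     ≡⟨ +-assoc 56 r (q * 7) ⟩
    56 + (r + q * 7)   ≡⟨ cong (56 +_) (m≡m%n+[m/n]*n (a ∸ 56) 7) ⟨
    56 + (a ∸ 56)      ≡⟨ m+[n∸m]≡n 56≤a ⟩
    a                  ∎
    where open ≡-Reasoning

improvable-large : ∀ {a} → 56 ≤ a → Improvable a
improvable-large {a} 56≤a =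
  *-cancelʳ-< (5 ^ a * scale) (N03 a) (N03P (decomposition a)) (begin-strict
  N03 a * (5 ^ a * scale)                   ≡⟨ *-assoc (N03 a) (5 ^ a) scale ⟨
  N03 a * 5 ^ a * scale
    ≤⟨ N03-exponential (≤-trans (byDecision (20 ≤? 56) refl) 56≤a) ⟩
  G∞ * 6 ^ a                                <⟨ Outgrows.bound (outgrows 56≤a) ⟩
  N03P (decomposition a) * 5 ^ a * scale    ≡⟨ *-assoc (N03P (decomposition a)) (5 ^ a) scale ⟩
  N03P (decomposition a) * (5 ^ a * scale)  ∎)
  where open ≤-Reasoning

classify : ∀ x → 1 ≤ x → x ∈ admissibleParts ⊎ Improvable x
classify x 1≤x with x <? 34 | x <? 56
... | yes x<34 | _        = classify-small x<34 1≤x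
... | no  x≮34 | yes x<56 = inj₂ (improvable-medium x<56 (≮⇒≥ x≮34))
... | no  _    | no  x≮56 = inj₂ (improvable-large (≮⇒≥ x≮56))

ExceptionalPair : ℕ → ℕ → Set
ExceptionalPair a b = (a ≡ 4 × b ≡ 1) ⊎ (a ≡ 13 × b ≡ 10)

admissible-pair : ∀ {a b} → a ∈ admissibleParts → b ∈ admissibleParts → b < a → a ≢ 7 → b ≢ 7 →
                  N03P (decomposition (a + b)) ≤ N03 a * N03 b → ExceptionalPair a b
admissible-pair a∈ b∈ = All.lookup (All.lookup allPairs a∈) b∈
  where
  exceptional? : ∀ a b → Dec (ExceptionalPair a b)
  exceptional? a b = (a ≟ 4 ×-dec b ≟ 1) ⊎-dec (a ≟ 13 ×-dec b ≟ 10)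
  allPairs = byDecision (all? (λ a → all? (λ b →
    b <? a →-dec ¬? (a ≟ 7) →-dec ¬? (b ≟ 7) →-dec
      N03P (decomposition (a + b)) ≤? N03 a * N03 b →-dec exceptional? a b)
    admissibleParts) admissibleParts) refl

1≤N03-1 : 1 ≤ N03 1
1≤N03-1 = ≤-refl

maximal-part-admissible : ∀ {n λs x} → IsPartition n λs → IsMaximal N03 n λs →
                          x ∈ λs → x ∈ admissibleParts
maximal-part-admissible {x = x} part@(_ , pos , _) maximal x∈λs
  with classify x (All.lookup pos x∈λs)
... | inj₁ x∈admissible = x∈admissible
... | inj₂ improvable   = contradiction
  (maximal-part-optimal 1≤N03-1 part maximal x∈λs (decomposition-decomposes x)) (<⇒≱ improvable)

proposition3p4 : (n : ℕ) → n ≥ 1 → (λs : List ℕ) → IsPartition n λs →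
    ((μ : List ℕ) → IsPartition n μ → N03P μ ≤ N03P λs) →
    (a b : ℕ) → a > b → a ≢ 7 → b ≢ 7 → mult a λs ≡ 1 → mult b λs ≡ 1 →
    (a ≡ 4 × b ≡ 1) ⊎ (a ≡ 13 × b ≡ 10)
proposition3p4 n _ λs part maximal a b b<a a≢7 b≢7 ma mb =
  admissible-pair (maximal-part-admissible part maximal a∈λs)
                  (maximal-part-admissible part maximal b∈λs) b<a a≢7 b≢7
                  (maximal-pair-optimal 1≤N03-1 part maximal a∈λs b∈λs (>⇒≢ b<a)
                                        (decomposition-decomposes (a + b)))
  where
  a∈λs = mult≡1⇒∈ ma
  b∈λs = mult≡1⇒∈ mb
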